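{- Fix $k\ge2$ and define $F^{(k)}_1=\cdots=F^{(k)}_k=1$ and $F^{(k)}_{i+1}=F^{(k)}_i+F^{(k)}_{i-1}+\cdots+F^{(k)}_{i-k+1}$ for $i\ge k$. Let $t$ be an indeterminate (or complex number) and let $v^{(k)}_2(n,t)$ be the sum of the squares of the coefficients of the polynomial $\prod_{i=1}^n\left(1+tx^{F^{(k)}_{i+k-1}}\right)$ in $x$. Then $$\sum_{n\ge0}v^{(k)}_2(n,t)x^n=\frac{1-t^{k-1}(1+t^2)x^k}{1-(1+t^2)x-t^{k-1}(1+t^2)x^k+t^{k-1}(1+t^4)x^{k+1}}.$$ -}

module Defs where

open import Level using (Level)
open import Data.Nat as ℕ using (ℕ; zero; suc; _≤?_)
open import Data.List as List using (List; []; _∷_; take; replicate; _++_; map; foldr)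
open import Relation.Nullary using (yes; no)
open import Data.Nat.ListAction using (sum)
open import Algebra.Bundles using (CommutativeRing)

-- k-generalized Fibonacci numbers (paper's indexing, starting at 1).
-- fibList k n = [F_n, F_{n-1}, ..., F_1]
-- F_1 = ... = F_k = 1,  F_{i+1} = F_i + ... + F_{i-k+1} for i ≥ k.

fibList : ℕ → ℕ → List ℕ
fibList k zero    = []
fibList k (suc n) with suc n ≤? k
... | yes _ = 1 ∷ fibList k n
... | no  _ = sum (take k (fibList k n)) ∷ fibList k n

-- F k i = F^{(k)}_i  for i ≥ 1  (F k 0 = 0 is an unused junk value)
F : ℕ → ℕ → ℕ
F k i with fibList k i
... | []    = 0
... | x ∷ _ = x

-- Polynomials (coefficient lists, lowest degree first) and formal power
-- series (ℕ → R) over a commutative ring R.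

module Ops {c ℓ : Level} (R : CommutativeRing c ℓ) where
  open CommutativeRing R

  Poly : Set c
  Poly = List Carrier

  _⊕_ : Poly → Poly → Poly
  []       ⊕ q        = q
  (a ∷ p)  ⊕ []       = a ∷ p
  (a ∷ p)  ⊕ (b ∷ q)  = (a + b) ∷ (p ⊕ q)

  scale : Carrier → Poly → Poly
  scale s p = map (s *_) p

  shift : ℕ → Poly → Poly
  shift m p = replicate m 0# ++ p

  mono : Carrier → ℕ → Poly
  mono a m = shift m (a ∷ [])

  pow : Carrier → ℕ → Carrier
  pow a zero    = 1#
  pow a (suc n) = a * pow a n

  prodPoly : ℕ → Carrier → ℕ → Poly
  prodPoly k t zero    = 1# ∷ []
  prodPoly k t (suc n) =
    let p = prodPoly k t n in p ⊕ scale t (shift (F k (suc n ℕ.+ k ℕ.∸ 1)) p)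

  sumR : List Carrier → Carrier
  sumR = foldr _+_ 0#

  v₂ : ℕ → Carrier → ℕ → Carrier
  v₂ k t n = sumR (map (λ a → a * a) (prodPoly k t n))

  Series : Set c
  Series = ℕ → Carrier

  toS : Poly → Series
  toS []      n       = 0#
  toS (a ∷ p) zero    = a
  toS (a ∷ p) (suc n) = toS p n

  _⊛_ : Series → Series → Series
  (f ⊛ g) n = sumR (map (λ i → f i * g (n ℕ.∸ i)) (List.upTo (suc n)))

  num : ℕ → Carrier → Poly
  num k t = mono 1# 0 ⊕ mono (- (pow t (k ℕ.∸ 1) * (1# + pow t 2))) k

  den : ℕ → Carrier → Poly
  den k t =
    mono 1# 0
    ⊕ (mono (- (1# + pow t 2)) 1
    ⊕ (mono (- (pow t (k ℕ.∸ 1) * (1# + pow t 2))) k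
    ⊕ mono (pow t (k ℕ.∸ 1) * (1# + pow t 4)) (suc k)))

  V : ℕ → Carrier → Series
  V k t n = v₂ k t n

module Submission where

-- Let P n = ∏_{i ≤ n} (1 + t x^{E i}) with E i = F_{i+k-1}, and let C n d = Σ_j c_j c_{j+d} be the
-- autocorrelation of its coefficients, so that v₂ n = C n 0. Multiplying by 1 + t x^e turns the
-- autocorrelation at lag d into that of the old polynomial at lags d, d - e, d + e, d; this gives
-- v (n+1) = (1 + t²) v n + 2t a n with a n = C n (E (n+1)). As deg P n = E 1 + ⋯ + E n, the lag
-- E (n+1) exceeds the degree for n < k, so a n = 0. For n = q + k the Fibonacci recurrence makes
-- E (n+1) the sum of the top k exponents E (q+1), …, E n; peeling off the factors of E n, …, E (q+2)
-- only multiplies by t each time, and one more step gives a n = t^{k-1} (a q + t v q + t² a q).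
-- Eliminating a leaves a linear recurrence for v whose characteristic polynomial is the
-- denominator; the initial values account for the numerator.

open import Level using (Level)
open import Algebra.Bundles using (CommutativeRing)
open import Data.Nat as ℕ using (ℕ; zero; suc; _≤_; _<_; z≤n; s≤s)
import Data.Nat.Properties as ℕ
open import Data.List using (List; []; _∷_; length; replicate; _++_; map; take; applyUpTo)
import Data.List.Properties as List
open import Data.Nat.ListAction using (sum)
open import Data.Nat.ListAction.Properties using (sum-++)
open import Relation.Binary.PropositionalEquality as ≡ using (_≡_; _≢_; cong)
open import Relation.Nullary using (yes; no; contradiction)
open import Function using (_∘_; id)
open import Algebra.Properties.CommutativeSemigroup ℕ.+-commutativeSemigroup
  using () renaming (x∙yz≈y∙xz to m+[n+o]≡n+[m+o])
open import Defs

module FiniteSums {c ℓ} (R : CommutativeRing c ℓ) where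
  open CommutativeRing R

  ∑ : ℕ → (ℕ → Carrier) → Carrier
  ∑ zero    f = 0#
  ∑ (suc n) f = f 0 + ∑ n (λ i → f (suc i))

  ∑-cong : ∀ n {f g} → (∀ i → f i ≈ g i) → ∑ n f ≈ ∑ n g
  ∑-cong zero    f≈g = refl
  ∑-cong (suc n) f≈g = +-cong (f≈g 0) (∑-cong n (λ i → f≈g (suc i)))

  ∑-zero : ∀ n {f} → (∀ i → f i ≈ 0#) → ∑ n f ≈ 0#
  ∑-zero zero    f≈0 = refl
  ∑-zero (suc n) f≈0 = trans (+-cong (f≈0 0) (∑-zero n (λ i → f≈0 (suc i)))) (+-identityˡ 0#)

  ∑-distrib-+ : ∀ n f g → ∑ n (λ i → f i + g i) ≈ ∑ n f + ∑ n g
  ∑-distrib-+ zero    f g = sym (+-identityˡ 0#)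
  ∑-distrib-+ (suc n) f g = trans (+-congˡ (∑-distrib-+ n _ _)) (interchange _ _ _ _)
    where open import Algebra.Properties.CommutativeSemigroup +-commutativeSemigroup using (interchange)

  ∑-distribˡ-* : ∀ n a f → ∑ n (λ i → a * f i) ≈ a * ∑ n f
  ∑-distribˡ-* zero    a f = sym (zeroʳ a)
  ∑-distribˡ-* (suc n) a f = trans (+-congˡ (∑-distribˡ-* n a _)) (sym (distribˡ a _ _))

  ∑-split : ∀ m n f → ∑ (m ℕ.+ n) f ≈ ∑ m f + ∑ n (λ i → f (m ℕ.+ i))
  ∑-split zero    n f = sym (+-identityˡ _)
  ∑-split (suc m) n f = trans (+-congˡ (∑-split m n _)) (sym (+-assoc _ _ _))

  ∑-vanishing-tail : ∀ m n f → (∀ i → f (m ℕ.+ i) ≈ 0#) → ∑ (m ℕ.+ n) f ≈ ∑ m f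
  ∑-vanishing-tail m n f f≈0 = trans (∑-split m n f) (trans (+-congˡ (∑-zero n f≈0)) (+-identityʳ _))

module Correlation {c ℓ} (R : CommutativeRing c ℓ) where
  open CommutativeRing R
  open FiniteSums R
  open import Relation.Binary.Reasoning.Setoid setoid
  open import Algebra.Solver.Ring.NaturalCoefficients.Default commutativeSemiring

  VanishesFrom : ℕ → (ℕ → Carrier) → Set ℓ
  VanishesFrom L f = ∀ i → f (L ℕ.+ i) ≈ 0#

  ∑-*-VanishesFrom : ∀ m L f (h : ℕ → Carrier) → VanishesFrom L f →
                     ∑ (m ℕ.+ L) (λ j → f j * h j) ≈ ∑ L (λ j → f j * h j)
  ∑-*-VanishesFrom m L f h f-van = begin
    ∑ (m ℕ.+ L) fh ≡⟨ cong (λ n → ∑ n fh) (ℕ.+-comm m L) ⟩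
    ∑ (L ℕ.+ m) fh ≈⟨ ∑-vanishing-tail L m fh (λ i → trans (*-congʳ (f-van i)) (zeroˡ _)) ⟩
    ∑ L fh         ∎
    where
    fh : ℕ → Carrier
    fh j = f j * h j

  shiftSeries : ℕ → (ℕ → Carrier) → ℕ → Carrier
  shiftSeries zero    f j       = f j
  shiftSeries (suc e) f zero    = 0#
  shiftSeries (suc e) f (suc j) = shiftSeries e f j

  shiftSeries-+ : ∀ e f i → shiftSeries e f (e ℕ.+ i) ≡ f i
  shiftSeries-+ zero    f i = ≡.refl
  shiftSeries-+ (suc e) f i = shiftSeries-+ e f i

  ∑-shiftSeries : ∀ e L f (h : ℕ → Carrier) → ∑ (e ℕ.+ L) (λ j → shiftSeries e f j * h j) ≈ ∑ L (λ i → f i * h (e ℕ.+ i))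
  ∑-shiftSeries zero    L f h = refl
  ∑-shiftSeries (suc e) L f h =
    trans (+-cong (zeroˡ (h 0)) (∑-shiftSeries e L f (λ j → h (suc j)))) (+-identityˡ _)

  cor : ℕ → (ℕ → Carrier) → ℕ → Carrier
  cor L f d = ∑ L (λ j → f j * f (d ℕ.+ j))

  module TimesBinomial (t : Carrier) (e L : ℕ) (f : ℕ → Carrier) (f-van : VanishesFrom L f) where
    s g : ℕ → Carrier
    s = shiftSeries e f
    g j = f j + t * s j

    cor-g : ∀ d → cor (e ℕ.+ L) g d ≈
      cor L f d + t * ∑ (e ℕ.+ L) (λ j → f j * s (d ℕ.+ j)) + t * cor L f (d ℕ.+ e) + t * t * cor L f d
    cor-g d = begin
      ∑ M (λ j → g j * g (d ℕ.+ j))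
        ≈⟨ ∑-cong M (λ j → expand (f j) (f (d ℕ.+ j)) (s j) (s (d ℕ.+ j))) ⟩
      ∑ M (λ j → A j + t * B j + t * C j + t * t * D j)
        ≈⟨ trans (∑-distrib-+ M _ _) (+-congʳ (trans (∑-distrib-+ M _ _) (+-congʳ (∑-distrib-+ M _ _)))) ⟩
      ∑ M A + ∑ M (λ j → t * B j) + ∑ M (λ j → t * C j) + ∑ M (λ j → t * t * D j)
        ≈⟨ +-cong (+-cong (+-cong (∑-*-VanishesFrom e L f (λ j → f (d ℕ.+ j)) f-van) (∑-distribˡ-* M t B))
                          (trans (∑-distribˡ-* M t C) (*-congˡ ∑C)))
                  (trans (∑-distribˡ-* M (t * t) D) (*-congˡ ∑D)) ⟩
      cor L f d + t * ∑ M B + t * cor L f (d ℕ.+ e) + t * t * cor L f d ∎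
      where
      M = e ℕ.+ L
      A B C D : ℕ → Carrier
      A j = f j * f (d ℕ.+ j)
      B j = f j * s (d ℕ.+ j)
      C j = s j * f (d ℕ.+ j)
      D j = s j * s (d ℕ.+ j)
      expand : ∀ a b x y → (a + t * x) * (b + t * y) ≈ a * b + t * (a * y) + t * (x * b) + t * t * (x * y)
      expand a b x y = solve 5 (λ a b x y t → (a :+ t :* x) :* (b :+ t :* y)
                                  := a :* b :+ t :* (a :* y) :+ t :* (x :* b) :+ t :* t :* (x :* y)) refl a b x y t
      ∑C : ∑ M C ≈ cor L f (d ℕ.+ e)
      ∑C = trans (∑-shiftSeries e L f (λ j → f (d ℕ.+ j)))
                 (∑-cong L (λ i → reflexive (cong (λ n → f i * f n) (≡.sym (ℕ.+-assoc d e i)))))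
      ∑D : ∑ M D ≈ cor L f d
      ∑D = trans (∑-shiftSeries e L f (λ j → s (d ℕ.+ j))) (∑-cong L (λ i → reflexive (cong (f i *_)
             (≡.trans (cong s (m+[n+o]≡n+[m+o] d e i)) (shiftSeries-+ e f (d ℕ.+ i))))))

    cor-g-0 : cor (e ℕ.+ L) g 0 ≈ cor L f 0 + t * cor L f e + t * cor L f e + t * t * cor L f 0
    cor-g-0 = trans (cor-g 0) (+-congʳ (+-congʳ (+-congˡ (*-congˡ cross))))
      where
      cross : ∑ (e ℕ.+ L) (λ j → f j * s j) ≈ cor L f e
      cross = trans (∑-cong (e ℕ.+ L) (λ j → *-comm (f j) (s j))) (∑-shiftSeries e L f f)

    cor-g-+e : ∀ d → cor (e ℕ.+ L) g (e ℕ.+ d) ≈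
      cor L f (e ℕ.+ d) + t * cor L f d + t * cor L f (e ℕ.+ d ℕ.+ e) + t * t * cor L f (e ℕ.+ d)
    cor-g-+e d = trans (cor-g (e ℕ.+ d)) (+-congʳ (+-congʳ (+-congˡ (*-congˡ cross))))
      where
      cross : ∑ (e ℕ.+ L) (λ j → f j * s (e ℕ.+ d ℕ.+ j)) ≈ cor L f d
      cross = trans (∑-cong (e ℕ.+ L) (λ j → reflexive (cong (f j *_)
                      (≡.trans (cong s (ℕ.+-assoc e d j)) (shiftSeries-+ e f (d ℕ.+ j))))))
                    (∑-*-VanishesFrom e L f (λ j → f (d ℕ.+ j)) f-van)

module Coefficients {c ℓ} (R : CommutativeRing c ℓ) where
  open CommutativeRing R
  open Ops R
  open FiniteSums R
  open Correlation R
  open import Relation.Binary.Reasoning.Setoid setoid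

  toS-⊕ : ∀ p q j → toS (p ⊕ q) j ≈ toS p j + toS q j
  toS-⊕ []      q       j       = sym (+-identityˡ _)
  toS-⊕ (a ∷ p) []      j       = sym (+-identityʳ _)
  toS-⊕ (a ∷ p) (b ∷ q) zero    = refl
  toS-⊕ (a ∷ p) (b ∷ q) (suc j) = toS-⊕ p q j

  toS-scale : ∀ s p j → toS (scale s p) j ≈ s * toS p j
  toS-scale s []      j       = sym (zeroʳ s)
  toS-scale s (a ∷ p) zero    = refl
  toS-scale s (a ∷ p) (suc j) = toS-scale s p j

  toS-shift : ∀ e p j → toS (shift e p) j ≡ shiftSeries e (toS p) j
  toS-shift zero    p j       = ≡.refl
  toS-shift (suc e) p zero    = ≡.refl
  toS-shift (suc e) p (suc j) = toS-shift e p j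

  toS-step : ∀ s e p j → toS (p ⊕ scale s (shift e p)) j ≈ toS p j + s * shiftSeries e (toS p) j
  toS-step s e p j = trans (toS-⊕ p _ j)
    (+-congˡ (trans (toS-scale s (shift e p) j) (*-congˡ (reflexive (toS-shift e p j)))))

  toS-vanishes : ∀ p → VanishesFrom (length p) (toS p)
  toS-vanishes []      i = refl
  toS-vanishes (a ∷ p) i = toS-vanishes p i

  toS-≥length : ∀ p {j} → length p ≤ j → toS p j ≈ 0#
  toS-≥length p {j} len≤j =
    trans (reflexive (cong (toS p) (≡.sym (ℕ.m+[n∸m]≡n len≤j)))) (toS-vanishes p (j ℕ.∸ length p))

  toS-mono-≡ : ∀ a m → toS (mono a m) m ≡ a
  toS-mono-≡ a zero    = ≡.refl
  toS-mono-≡ a (suc m) = toS-mono-≡ a m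

  toS-mono-≢ : ∀ a {m j} → j ≢ m → toS (mono a m) j ≡ 0#
  toS-mono-≢ a {zero}  {zero}  j≢m = contradiction ≡.refl j≢m
  toS-mono-≢ a {zero}  {suc j} j≢m = ≡.refl
  toS-mono-≢ a {suc m} {zero}  j≢m = ≡.refl
  toS-mono-≢ a {suc m} {suc j} j≢m = toS-mono-≢ a (j≢m ∘ cong suc)

  length-⊕ : ∀ p q → length p ≤ length q → length (p ⊕ q) ≡ length q
  length-⊕ []      q       _           = ≡.refl
  length-⊕ (a ∷ p) (b ∷ q) (s≤s len≤) = cong suc (length-⊕ p q len≤)

  length-step : ∀ s e p → length (p ⊕ scale s (shift e p)) ≡ e ℕ.+ length p
  length-step s e p = ≡.trans (length-⊕ p _ (≡.subst (length p ≤_) (≡.sym length-sp) (ℕ.m≤n+m _ e))) length-sp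
    where
    length-sp : length (scale s (shift e p)) ≡ e ℕ.+ length p
    length-sp = ≡.trans (List.length-map (s *_) (shift e p))
                  (≡.trans (List.length-++ (replicate e 0#)) (cong (ℕ._+ length p) (List.length-replicate e)))

  sumR-squares : ∀ p → sumR (map (λ a → a * a) p) ≈ cor (length p) (toS p) 0
  sumR-squares []      = refl
  sumR-squares (a ∷ p) = +-congˡ (sumR-squares p)

  sumR-applyUpTo : ∀ n h (g : ℕ → ℕ) → sumR (map h (applyUpTo g n)) ≈ ∑ n (h ∘ g)
  sumR-applyUpTo zero    h g = refl
  sumR-applyUpTo (suc n) h g = +-congˡ (sumR-applyUpTo n h (g ∘ suc))

  ⊛≈∑ : ∀ g f N → (g ⊛ f) N ≈ ∑ (suc N) (λ i → g i * f (N ℕ.∸ i))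
  ⊛≈∑ g f N = sumR-applyUpTo (suc N) (λ i → g i * f (N ℕ.∸ i)) id

  ⊛-⊕ : ∀ p q f N → (toS (p ⊕ q) ⊛ f) N ≈ (toS p ⊛ f) N + (toS q ⊛ f) N
  ⊛-⊕ p q f N = begin
    (toS (p ⊕ q) ⊛ f) N                            ≈⟨ ⊛≈∑ (toS (p ⊕ q)) f N ⟩
    ∑ (suc N) (λ i → toS (p ⊕ q) i * w i)          ≈⟨ ∑-cong (suc N) (λ i → trans (*-congʳ (toS-⊕ p q i)) (distribʳ (w i) _ _)) ⟩
    ∑ (suc N) (λ i → toS p i * w i + toS q i * w i) ≈⟨ ∑-distrib-+ (suc N) (λ i → toS p i * w i) (λ i → toS q i * w i) ⟩
    ∑ (suc N) (λ i → toS p i * w i) + ∑ (suc N) (λ i → toS q i * w i)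
                                                    ≈⟨ sym (+-cong (⊛≈∑ (toS p) f N) (⊛≈∑ (toS q) f N)) ⟩
    (toS p ⊛ f) N + (toS q ⊛ f) N                  ∎
    where
    w : ℕ → Carrier
    w i = f (N ℕ.∸ i)

  ∑-mono-< : ∀ a {m M} w → m < M → ∑ M (λ i → toS (mono a m) i * w i) ≈ a * w m
  ∑-mono-< a {zero}  {suc M} w _ = trans (+-congˡ (∑-zero M (λ i → zeroˡ _))) (+-identityʳ _)
  ∑-mono-< a {suc m} {suc M} w (s≤s m<M) =
    trans (+-cong (zeroˡ _) (∑-mono-< a (λ i → w (suc i)) m<M)) (+-identityˡ _)

  ∑-mono-≥ : ∀ a {m M} w → M ≤ m → ∑ M (λ i → toS (mono a m) i * w i) ≈ 0#
  ∑-mono-≥ a {m}     {zero}  w M≤m       = refl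
  ∑-mono-≥ a {suc m} {suc M} w (s≤s M≤m) =
    trans (+-cong (zeroˡ _) (∑-mono-≥ a (λ i → w (suc i)) M≤m)) (+-identityˡ _)

  ⊛-mono-≤ : ∀ a m f N → m ≤ N → (toS (mono a m) ⊛ f) N ≈ a * f (N ℕ.∸ m)
  ⊛-mono-≤ a m f N m≤N = trans (⊛≈∑ (toS (mono a m)) f N) (∑-mono-< a (λ i → f (N ℕ.∸ i)) (s≤s m≤N))

  ⊛-mono-> : ∀ a m f N → N < m → (toS (mono a m) ⊛ f) N ≈ 0#
  ⊛-mono-> a m f N N<m = trans (⊛≈∑ (toS (mono a m)) f N) (∑-mono-≥ a (λ i → f (N ℕ.∸ i)) N<m)

module _ {a} {A : Set a} where

  take-++-length : ∀ (l r : List A) j → take (length l ℕ.+ j) (l ++ r) ≡ l ++ take j r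
  take-++-length []      r j = ≡.refl
  take-++-length (x ∷ l) r j = cong (x ∷_) (take-++-length l r j)

  take-++-≤ : ∀ n (l r : List A) → n ≤ length l → take n (l ++ r) ≡ take n l
  take-++-≤ zero    l       r _          = ≡.refl
  take-++-≤ (suc n) (x ∷ l) r (s≤s n≤l) = cong (x ∷_) (take-++-≤ n l r n≤l)

module Exponents (k₀ : ℕ) where

  k k′ : ℕ
  k′ = suc k₀
  k  = suc k′

  E : ℕ → ℕ
  E i = F k (i ℕ.+ k ℕ.∸ 1)

  Es : ℕ → List ℕ
  Es zero    = []
  Es (suc n) = E (suc n) ∷ Es n

  ΣE : ℕ → ℕ
  ΣE n = sum (Es n)

  fibList-suc : ∀ n → fibList k (suc n) ≡ F k (suc n) ∷ fibList k n
  fibList-suc n with suc n ℕ.≤? k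
  ... | yes _ = ≡.refl
  ... | no  _ = ≡.refl

  fibList-≤ : ∀ n → n ≤ k → fibList k n ≡ replicate n 1
  fibList-≤ zero    _   = ≡.refl
  fibList-≤ (suc n) n<k with suc n ℕ.≤? k
  ... | yes _   = cong (1 ∷_) (fibList-≤ n (ℕ.<⇒≤ n<k))
  ... | no  n≮k = contradiction n<k n≮k

  F-suc : ∀ n → k ≤ n → F k (suc n) ≡ sum (take k (fibList k n))
  F-suc n k≤n with suc n ℕ.≤? k
  ... | yes n<k = contradiction (ℕ.≤-trans n<k k≤n) (ℕ.n≮n n)
  ... | no  _   = ≡.refl

  fibList-Es : ∀ n → fibList k (n ℕ.+ k′) ≡ Es n ++ replicate k′ 1
  fibList-Es zero    = fibList-≤ k′ (ℕ.n≤1+n k′)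
  fibList-Es (suc n) = ≡.trans (fibList-suc (n ℕ.+ k′))
    (≡.cong₂ _∷_ (cong (F k) (≡.sym (ℕ.+-suc n k′))) (fibList-Es n))

  length-Es : ∀ n → length (Es n) ≡ n
  length-Es zero    = ≡.refl
  length-Es (suc n) = cong suc (length-Es n)

  E-one : E 1 ≡ 1
  E-one = List.∷-injectiveˡ (≡.trans (≡.sym (fibList-suc k′)) (fibList-≤ k ℕ.≤-refl))

  E-suc : ∀ n → E (suc (suc n)) ≡ sum (take k (Es (suc n) ++ replicate k′ 1))
  E-suc n = begin
    F k (suc (n ℕ.+ k))                       ≡⟨ F-suc (n ℕ.+ k) (ℕ.m≤n+m k n) ⟩
    sum (take k (fibList k (n ℕ.+ k)))        ≡⟨ cong (sum ∘ take k ∘ fibList k) (ℕ.+-suc n k′) ⟩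
    sum (take k (fibList k (suc n ℕ.+ k′)))   ≡⟨ cong (sum ∘ take k) (fibList-Es (suc n)) ⟩
    sum (take k (Es (suc n) ++ replicate k′ 1)) ∎
    where open ≡.≡-Reasoning

  E-≤-suc : ∀ n → E (suc n) ≤ E (suc (suc n))
  E-≤-suc n = ≡.subst (E (suc n) ≤_) (≡.sym (E-suc n)) (ℕ.m≤m+n _ _)

  E-positive : ∀ n → 0 < E (suc n)
  E-positive zero    = ℕ.≤-reflexive (≡.sym E-one)
  E-positive (suc n) = ℕ.≤-trans (E-positive n) (E-≤-suc n)

  E-mono : ∀ m n → E (suc n) ≤ E (suc (m ℕ.+ n))
  E-mono zero    n = ℕ.≤-refl
  E-mono (suc m) n = ℕ.≤-trans (E-mono m n) (E-≤-suc (m ℕ.+ n))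

  ΣE-<-E : ∀ n → n < k → ΣE n < E (suc n)
  ΣE-<-E zero    _   = E-positive 0
  ΣE-<-E (suc n) n<k = ≡.subst (ΣE (suc n) <_) (≡.sym E≡) (ℕ.m<m+n (ΣE (suc n)) (ones-positive (ℕ.m<n⇒0<n∸m n<k)))
    where
    j = k ℕ.∸ suc n
    l = Es (suc n)
    ones-positive : ∀ {i} → 0 < i → 0 < sum (take i (replicate k′ 1))
    ones-positive {suc i} _ = s≤s z≤n
    k≡ : length l ℕ.+ j ≡ k
    k≡ = ≡.trans (cong (ℕ._+ j) (length-Es (suc n))) (ℕ.m+[n∸m]≡n (ℕ.<⇒≤ n<k))
    E≡ : E (suc (suc n)) ≡ ΣE (suc n) ℕ.+ sum (take j (replicate k′ 1))
    E≡ = begin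
      E (suc (suc n))                                    ≡⟨ E-suc n ⟩
      sum (take k (l ++ replicate k′ 1))                 ≡⟨ cong (λ i → sum (take i (l ++ replicate k′ 1))) (≡.sym k≡) ⟩
      sum (take (length l ℕ.+ j) (l ++ replicate k′ 1))  ≡⟨ cong sum (take-++-length l _ j) ⟩
      sum (l ++ take j (replicate k′ 1))                 ≡⟨ sum-++ l _ ⟩
      ΣE (suc n) ℕ.+ sum (take j (replicate k′ 1))       ∎
      where open ≡.≡-Reasoning

  -- k ≥ 2: the k summands of E (n+3) include both E (n+2) and E (n+1).
  ΣE-<-E-suc : ∀ n → ΣE n < E (suc (suc n))
  ΣE-<-E-suc zero    = E-positive 1
  ΣE-<-E-suc (suc n) = begin-strict
    ΣE (suc n)                                         ≡⟨ ℕ.+-comm (E (suc n)) (ΣE n) ⟩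
    ΣE n ℕ.+ E (suc n)                                 <⟨ ℕ.+-monoˡ-< (E (suc n)) (ΣE-<-E-suc n) ⟩
    E (suc (suc n)) ℕ.+ E (suc n)                      ≤⟨ ℕ.+-monoʳ-≤ (E (suc (suc n))) (ℕ.m≤m+n _ _) ⟩
    sum (take k (Es (suc (suc n)) ++ replicate k′ 1))  ≡⟨ ≡.sym (E-suc (suc n)) ⟩
    E (suc (suc (suc n)))                              ∎
    where open ℕ.≤-Reasoning

  ΣE-<-2E : ∀ n → ΣE n < E (suc n) ℕ.+ E (suc n)
  ΣE-<-2E zero    = ℕ.≤-trans (E-positive 0) (ℕ.m≤m+n _ _)
  ΣE-<-2E (suc n) = begin-strict
    E (suc n) ℕ.+ ΣE n                   <⟨ ℕ.+-monoʳ-< (E (suc n)) (ΣE-<-E-suc n) ⟩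
    E (suc n) ℕ.+ E (suc (suc n))        ≤⟨ ℕ.+-monoˡ-≤ (E (suc (suc n))) (E-≤-suc n) ⟩
    E (suc (suc n)) ℕ.+ E (suc (suc n))  ∎
    where open ℕ.≤-Reasoning

  E-window : ∀ q → E (suc (k′ ℕ.+ suc q)) ≡ sum (take k (Es (k′ ℕ.+ suc q)))
  E-window q = ≡.trans (E-suc (k₀ ℕ.+ suc q)) (cong sum (take-++-≤ k (Es n) _ k≤n))
    where
    n = k′ ℕ.+ suc q
    k≤n : k ≤ length (Es n)
    k≤n = ≡.subst (k ≤_) (≡.sym (≡.trans (length-Es n) (ℕ.+-suc k′ q))) (s≤s (ℕ.m≤m+n k′ q))

  ΣE-window : ∀ m q → sum (take (suc m) (Es (m ℕ.+ suc q))) ℕ.+ ΣE q ≡ ΣE (m ℕ.+ suc q)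
  ΣE-window zero    q = cong (ℕ._+ ΣE q) (ℕ.+-identityʳ (E (suc q)))
  ΣE-window (suc m) q = ≡.trans (ℕ.+-assoc (E (suc (m ℕ.+ suc q))) _ (ΣE q))
                                (cong (E (suc (m ℕ.+ suc q)) ℕ.+_) (ΣE-window m q))

module Recurrences {c ℓ} (R : CommutativeRing c ℓ) (k₀ : ℕ) (t : CommutativeRing.Carrier R) where
  open CommutativeRing R
  open Ops R
  open FiniteSums R
  open Correlation R
  open Coefficients R
  open Exponents k₀
  open import Relation.Binary.Reasoning.Setoid setoid
  open import Algebra.Solver.Ring.NaturalCoefficients.Default commutativeSemiring

  P : ℕ → Poly
  P n = prodPoly k t n

  C : ℕ → ℕ → Carrier
  C n = cor (length (P n)) (toS (P n))

  v a : ℕ → Carrier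
  v n = C n 0
  a n = C n (E (suc n))

  v₂≈v : ∀ n → v₂ k t n ≈ v n
  v₂≈v n = sumR-squares (P n)

  length-P : ∀ n → length (P n) ≡ suc (ΣE n)
  length-P zero    = ≡.refl
  length-P (suc n) = ≡.trans (length-step t (E (suc n)) (P n))
                       (≡.trans (cong (E (suc n) ℕ.+_) (length-P n)) (ℕ.+-suc _ _))

  C-vanishing : ∀ n {d} → ΣE n < d → C n d ≈ 0#
  C-vanishing n {d} ΣE<d = ∑-zero (length (P n)) (λ j →
    trans (*-congˡ (toS-≥length (P n) (≡.subst (_≤ d ℕ.+ j) (≡.sym (length-P n)) (ℕ.≤-trans ΣE<d (ℕ.m≤m+n d j)))))
          (zeroʳ _))

  module NextFactor (n : ℕ) = TimesBinomial t (E (suc n)) (length (P n)) (toS (P n)) (toS-vanishes (P n))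

  C-suc : ∀ n d → C (suc n) d ≈ cor (E (suc n) ℕ.+ length (P n)) (NextFactor.g n) d
  C-suc n d = trans (reflexive (cong (λ L → cor L (toS (P (suc n))) d) (length-step t (E (suc n)) (P n))))
                    (∑-cong (E (suc n) ℕ.+ length (P n)) (λ j → *-cong (toS-step t (E (suc n)) (P n) j) (toS-step t (E (suc n)) (P n) (d ℕ.+ j))))

  v-suc : ∀ n → v (suc n) ≈ v n + t * a n + t * a n + t * t * v n
  v-suc n = trans (C-suc n 0) (NextFactor.cor-g-0 n)

  a-small : ∀ n → n < k → a n ≈ 0#
  a-small n n<k = C-vanishing n (ΣE-<-E n n<k)

  C-suc-at-E : ∀ q → C (suc q) (E (suc q)) ≈ a q + t * v q + t * t * a q
  C-suc-at-E q = begin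
    C (suc q) e
      ≡⟨ cong (C (suc q)) (≡.sym (ℕ.+-identityʳ e)) ⟩
    C (suc q) (e ℕ.+ 0)
      ≈⟨ trans (C-suc q (e ℕ.+ 0)) (NextFactor.cor-g-+e q 0) ⟩
    C q (e ℕ.+ 0) + t * v q + t * C q (e ℕ.+ 0 ℕ.+ e) + t * t * C q (e ℕ.+ 0)
      ≈⟨ +-cong (+-cong (+-congʳ C≈a) (trans (*-congˡ (C-vanishing q ΣE<2e)) (zeroʳ t))) (*-congˡ C≈a) ⟩
    a q + t * v q + 0# + t * t * a q
      ≈⟨ +-congʳ (+-identityʳ _) ⟩
    a q + t * v q + t * t * a q ∎
    where
    e = E (suc q)
    C≈a : C q (e ℕ.+ 0) ≈ a q
    C≈a = reflexive (cong (C q) (ℕ.+-identityʳ e))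
    ΣE<2e : ΣE q < e ℕ.+ 0 ℕ.+ e
    ΣE<2e = ≡.subst (λ x → ΣE q < x ℕ.+ e) (≡.sym (ℕ.+-identityʳ e)) (ΣE-<-2E q)

  -- Removing the top factor only keeps the cross term t · C n w: all other lags exceed deg P n.
  C-window : ∀ m q → C (m ℕ.+ suc q) (sum (take (suc m) (Es (m ℕ.+ suc q)))) ≈ pow t m * C (suc q) (E (suc q))
  C-window zero    q = trans (reflexive (cong (C (suc q)) (ℕ.+-identityʳ (E (suc q))))) (sym (*-identityˡ _))
  C-window (suc m) q = begin
    C (suc n) (e ℕ.+ w)
      ≈⟨ trans (C-suc n (e ℕ.+ w)) (NextFactor.cor-g-+e n w) ⟩
    C n (e ℕ.+ w) + t * C n w + t * C n (e ℕ.+ w ℕ.+ e) + t * t * C n (e ℕ.+ w)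
      ≈⟨ +-cong (+-cong (+-cong (C-vanishing n ΣE<e+w) refl) (trans (*-congˡ (C-vanishing n ΣE<e+w+e)) (zeroʳ t)))
                (trans (*-congˡ (C-vanishing n ΣE<e+w)) (zeroʳ _)) ⟩
      0# + t * C n w + 0# + 0#
      ≈⟨ trans (+-identityʳ _) (trans (+-identityʳ _) (+-identityˡ _)) ⟩
    t * C n w
      ≈⟨ *-congˡ (C-window m q) ⟩
    t * (pow t m * C (suc q) (E (suc q)))
      ≈⟨ sym (*-assoc _ _ _) ⟩
    pow t (suc m) * C (suc q) (E (suc q)) ∎
    where
    n = m ℕ.+ suc q
    e = E (suc n)
    w = sum (take (suc m) (Es n))
    ΣE<e+w : ΣE n < e ℕ.+ w
    ΣE<e+w = ≡.subst₂ _<_ (ΣE-window m q) (ℕ.+-comm w e)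
               (ℕ.+-monoʳ-< w (ℕ.<-≤-trans (ΣE-<-E-suc q) (E-mono m (suc q))))
    ΣE<e+w+e : ΣE n < e ℕ.+ w ℕ.+ e
    ΣE<e+w+e = ℕ.<-≤-trans ΣE<e+w (ℕ.m≤m+n _ e)

  a-large : ∀ q → a (k′ ℕ.+ suc q) ≈ pow t k′ * (a q + t * v q + t * t * a q)
  a-large q = trans (reflexive (cong (C (k′ ℕ.+ suc q)) (E-window q)))
                    (trans (C-window k′ q) (*-congˡ (C-suc-at-E q)))

  v₂-suc-small : ∀ n → n < k → v₂ k t (suc n) ≈ (1# + pow t 2) * v₂ k t n
  v₂-suc-small n n<k = begin
    v₂ k t (suc n)                                   ≈⟨ trans (v₂≈v (suc n)) (v-suc n) ⟩
    v n + t * a n + t * a n + t * t * v n            ≈⟨ +-congʳ (+-cong (+-congˡ (*-congˡ a≈0)) (*-congˡ a≈0)) ⟩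
    v n + t * 0# + t * 0# + t * t * v n              ≈⟨ solve 2 (λ x t → x :+ t :* con 0 :+ t :* con 0 :+ t :* t :* x
                                                                := (con 1 :+ t :* (t :* con 1)) :* x) refl (v n) t ⟩
    (1# + pow t 2) * v n                             ≈⟨ *-congˡ (sym (v₂≈v n)) ⟩
    (1# + pow t 2) * v₂ k t n                        ∎
    where a≈0 = a-small n n<k

  v₂-recurrence : ∀ q →
    v₂ k t (suc (k′ ℕ.+ suc q)) + pow t k′ * (1# + pow t 4) * v₂ k t q ≈
    (1# + pow t 2) * v₂ k t (k′ ℕ.+ suc q) + pow t k′ * (1# + pow t 2) * v₂ k t (suc q)
  v₂-recurrence q = begin
    v₂ k t (suc n) + p * (1# + pow t 4) * v₂ k t q
      ≈⟨ +-cong (trans (v₂≈v (suc n)) (trans (v-suc n) (+-congʳ (+-cong (+-congˡ (*-congˡ (a-large q))) (*-congˡ (a-large q))))))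
                (*-congˡ (v₂≈v q)) ⟩
    v n + t * (p * A) + t * (p * A) + t * t * v n + p * (1# + pow t 4) * v q
      ≈⟨ solve 5 (λ t p x aq vq →
           x :+ t :* (p :* (aq :+ t :* vq :+ t :* t :* aq)) :+ t :* (p :* (aq :+ t :* vq :+ t :* t :* aq)) :+ t :* t :* x
             :+ p :* (con 1 :+ t :* (t :* (t :* (t :* con 1)))) :* vq
           := (con 1 :+ t :* (t :* con 1)) :* x :+ p :* (con 1 :+ t :* (t :* con 1)) :* (vq :+ t :* aq :+ t :* aq :+ t :* t :* vq))
           refl t p (v n) (a q) (v q) ⟩
    (1# + pow t 2) * v n + p * (1# + pow t 2) * (v q + t * a q + t * a q + t * t * v q)
      ≈⟨ +-cong (*-congˡ (sym (v₂≈v n))) (*-congˡ (sym (trans (v₂≈v (suc q)) (v-suc q)))) ⟩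
    (1# + pow t 2) * v₂ k t n + p * (1# + pow t 2) * v₂ k t (suc q) ∎
    where
    n = k′ ℕ.+ suc q
    p = pow t k′
    A = a q + t * v q + t * t * a q

module GeneratingFunction {c ℓ} (R : CommutativeRing c ℓ) (k₀ : ℕ) (t : CommutativeRing.Carrier R) where
  open CommutativeRing R
  open Ops R
  open Coefficients R
  open Exponents k₀
  open Recurrences R k₀ t using (v₂-suc-small; v₂-recurrence)
  open import Relation.Binary.Reasoning.Setoid setoid
  open import Algebra.Properties.Ring ring using (-‿distribˡ-*)
  open import Relation.Binary.Definitions using (tri<; tri≈; tri>)
  open import Algebra.Properties.Group +-group using (x≈y⇒x∙y⁻¹≈ε)
  open import Algebra.Properties.AbelianGroup +-abelianGroup using (⁻¹-∙-comm)
  open import Algebra.Solver.Ring.NaturalCoefficients.Default commutativeSemiring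

  tᵏ⁻¹ 1+t² α β γ : Carrier
  tᵏ⁻¹ = pow t k′
  1+t² = 1# + pow t 2
  α    = - 1+t²
  β    = - (tᵏ⁻¹ * 1+t²)
  γ    = tᵏ⁻¹ * (1# + pow t 4)

  CoefficientsAgree : ℕ → Set ℓ
  CoefficientsAgree N = (toS (den k t) ⊛ V k t) N ≈ toS (num k t) N

  term : Carrier → ℕ → ℕ → Carrier
  term a m = toS (mono a m) ⊛ V k t

  den⊛V : ∀ N → (toS (den k t) ⊛ V k t) N ≈
          term 1# 0 N + (term α 1 N + (term β k N + term γ (suc k) N))
  den⊛V N = trans (⊛-⊕ (mono 1# 0) (mono α 1 ⊕ (mono β k ⊕ mono γ (suc k))) (V k t) N) (+-congˡ
            (trans (⊛-⊕ (mono α 1) (mono β k ⊕ mono γ (suc k)) (V k t) N) (+-congˡ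
                   (⊛-⊕ (mono β k) (mono γ (suc k)) (V k t) N))))

  num-at : ∀ N → toS (num k t) N ≈ toS (mono 1# 0) N + toS (mono β k) N
  num-at = toS-⊕ (mono 1# 0) (mono β k)

  coefficient-zero : CoefficientsAgree 0
  coefficient-zero = begin
    (toS (den k t) ⊛ V k t) 0
      ≈⟨ den⊛V 0 ⟩
    term 1# 0 0 + (term α 1 0 + (term β k 0 + term γ (suc k) 0))
      ≈⟨ +-cong (⊛-mono-≤ 1# 0 (V k t) 0 z≤n) (+-cong (⊛-mono-> α 1 (V k t) 0 (s≤s z≤n))
                (+-cong (⊛-mono-> β k (V k t) 0 (s≤s z≤n)) (⊛-mono-> γ (suc k) (V k t) 0 (s≤s z≤n)))) ⟩
    1# * (1# * 1# + 0#) + (0# + (0# + 0#))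
      ≈⟨ solve 0 (con 1 :* (con 1 :* con 1 :+ con 0) :+ (con 0 :+ (con 0 :+ con 0)) := con 1 :+ con 0) refl ⟩
    1# + 0#
      ≈⟨ sym (num-at 0) ⟩
    toS (num k t) 0 ∎

  coefficient-small : ∀ n → n < k′ → CoefficientsAgree (suc n)
  coefficient-small n n<k′ = begin
    (toS (den k t) ⊛ V k t) N
      ≈⟨ den⊛V N ⟩
    term 1# 0 N + (term α 1 N + (term β k N + term γ (suc k) N))
      ≈⟨ +-cong (⊛-mono-≤ 1# 0 (V k t) N z≤n) (+-cong (⊛-mono-≤ α 1 (V k t) N (s≤s z≤n))
                (+-cong (⊛-mono-> β k (V k t) N (s≤s n<k′)) (⊛-mono-> γ (suc k) (V k t) N (ℕ.m<n⇒m<1+n (s≤s n<k′))))) ⟩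
    1# * V k t N + (α * V k t n + (0# + 0#))
      ≈⟨ +-cong (*-identityˡ _) (trans (+-cong (sym (-‿distribˡ-* 1+t² _)) (+-identityʳ 0#)) (+-identityʳ _)) ⟩
    V k t N + - (1+t² * V k t n)
      ≈⟨ x≈y⇒x∙y⁻¹≈ε (v₂-suc-small n (ℕ.m<n⇒m<1+n n<k′)) ⟩
    0#
      ≈⟨ sym (trans (num-at N) (trans (+-congˡ (reflexive (toS-mono-≢ _ (ℕ.<⇒≢ (s≤s n<k′))))) (+-identityʳ 0#))) ⟩
    toS (num k t) N ∎
    where N = suc n

  coefficient-k : CoefficientsAgree k
  coefficient-k = begin
    (toS (den k t) ⊛ V k t) k
      ≈⟨ den⊛V k ⟩
    term 1# 0 k + (term α 1 k + (term β k k + term γ (suc k) k))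
      ≈⟨ +-cong (⊛-mono-≤ 1# 0 (V k t) k z≤n) (+-cong (⊛-mono-≤ α 1 (V k t) k (s≤s z≤n))
                (+-cong (⊛-mono-≤ β k (V k t) k ℕ.≤-refl) (⊛-mono-> γ (suc k) (V k t) k ℕ.≤-refl))) ⟩
    1# * V k t k + (α * V k t k′ + (β * V k t (k ℕ.∸ k) + 0#))
      ≈⟨ sym (+-assoc _ _ _) ⟩
    (1# * V k t k + α * V k t k′) + (β * V k t (k ℕ.∸ k) + 0#)
      ≈⟨ +-cong (trans (+-cong (*-identityˡ _) (sym (-‿distribˡ-* 1+t² _))) (x≈y⇒x∙y⁻¹≈ε (v₂-suc-small k′ (ℕ.n<1+n k′))))
                (trans (+-identityʳ _) (trans (*-congˡ V₀≈1) (*-identityʳ _))) ⟩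
    0# + - (tᵏ⁻¹ * 1+t²)
      ≈⟨ sym (trans (num-at k) (+-congˡ (reflexive (toS-mono-≡ _ k)))) ⟩
    toS (num k t) k ∎
    where
    V₀≈1 : V k t (k ℕ.∸ k) ≈ 1#
    V₀≈1 = trans (reflexive (cong (V k t) (ℕ.n∸n≡0 k))) (trans (+-identityʳ _) (*-identityˡ 1#))

  coefficient-large : ∀ q → CoefficientsAgree (suc (k′ ℕ.+ suc q))
  coefficient-large q = begin
    (toS (den k t) ⊛ V k t) N
      ≈⟨ den⊛V N ⟩
    term 1# 0 N + (term α 1 N + (term β k N + term γ (suc k) N))
      ≈⟨ +-cong (⊛-mono-≤ 1# 0 (V k t) N z≤n) (+-cong (⊛-mono-≤ α 1 (V k t) N (s≤s z≤n))
                (+-cong (⊛-mono-≤ β k (V k t) N (ℕ.<⇒≤ k<N)) (⊛-mono-≤ γ (suc k) (V k t) N k<N))) ⟩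
    1# * V k t N + (α * V k t n + (β * V k t (N ℕ.∸ k) + γ * V k t (N ℕ.∸ suc k)))
      ≈⟨ +-cong (*-identityˡ _) (+-cong (sym (-‿distribˡ-* 1+t² _))
                (+-cong (trans (sym (-‿distribˡ-* (tᵏ⁻¹ * 1+t²) _)) (-‿cong (*-congˡ (reflexive (cong (V k t) N∸k≡1+q)))))
                        (*-congˡ (reflexive (cong (V k t) N∸1+k≡q))))) ⟩
    V k t N + (- (1+t² * V k t n) + (- (tᵏ⁻¹ * 1+t² * V k t (suc q)) + γ * V k t q))
      ≈⟨ cancel (V k t N) _ _ (γ * V k t q) (v₂-recurrence q) ⟩
    0#
      ≈⟨ sym (trans (num-at N) (trans (+-congˡ (reflexive (toS-mono-≢ _ (ℕ.>⇒≢ k<N)))) (+-identityʳ 0#))) ⟩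
    toS (num k t) N ∎
    where
    n = k′ ℕ.+ suc q
    N = suc n
    k<N : k < N
    k<N = s≤s (s≤s (≡.subst (k₀ ℕ.<_) (≡.sym (ℕ.+-suc k₀ q)) (s≤s (ℕ.m≤m+n k₀ q))))
    N∸k≡1+q : N ℕ.∸ k ≡ suc q
    N∸k≡1+q = ℕ.m+n∸m≡n k′ (suc q)
    N∸1+k≡q : N ℕ.∸ suc k ≡ q
    N∸1+k≡q = ≡.trans (cong (ℕ._∸ k′) (ℕ.+-suc k₀ q)) (ℕ.m+n∸m≡n k₀ q)
    cancel : ∀ x y z w → x + w ≈ y + z → x + (- y + (- z + w)) ≈ 0#
    cancel x y z w x+w≈y+z = begin
      x + (- y + (- z + w)) ≈⟨ solve 4 (λ x y′ z′ w → x :+ (y′ :+ (z′ :+ w)) := (x :+ w) :+ (y′ :+ z′)) refl x (- y) (- z) w ⟩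
      (x + w) + (- y + - z) ≈⟨ +-congˡ (⁻¹-∙-comm y z) ⟩
      (x + w) + - (y + z)   ≈⟨ x≈y⇒x∙y⁻¹≈ε x+w≈y+z ⟩
      0#                    ∎

  coefficient : ∀ N → CoefficientsAgree N
  coefficient zero    = coefficient-zero
  coefficient (suc n) with ℕ.<-cmp n k′
  ... | tri< n<k′ _ _    = coefficient-small n n<k′
  ... | tri≈ _ ≡.refl _ = coefficient-k
  ... | tri> _ _ k′<n    = ≡.subst (CoefficientsAgree ∘ suc) n≡k′+1+q (coefficient-large (n ℕ.∸ k))
    where
    n≡k′+1+q : k′ ℕ.+ suc (n ℕ.∸ k) ≡ n
    n≡k′+1+q = ≡.trans (ℕ.+-suc k′ (n ℕ.∸ k)) (ℕ.m+[n∸m]≡n k′<n)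

theorem7 : ∀ {c ℓ : Level} (R : CommutativeRing c ℓ) (k : ℕ) → 2 ≤ k →
    (t : CommutativeRing.Carrier R) → (n : ℕ) →
    CommutativeRing._≈_ R (Ops._⊛_ R (Ops.toS R (Ops.den R k t)) (Ops.V R k t) n) (Ops.toS R (Ops.num R k t) n)
theorem7 R (suc (suc k₀)) (s≤s (s≤s z≤n)) t = GeneratingFunction.coefficient R k₀ t
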